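{- Let $G$ be a finite simple undirected graph, let $D \subset V(G)$, and let $P=(x_0,x_1,\ldots,x_p)$ be an acceptable $D$-ear in $G$. Then for every vertex $x$ of $P$, $d_G(x,D)=d_P(x,D)$.
   Context: For a graph $H$, a vertex $v$ and a set $S$ of vertices of $H$, $d_H(v,S)=\min_{s\in S} d_H(v,s)$, where $d_H$ is shortest-path distance in $H$. Given $D\subset V(G)$, a $D$-ear is a path $P=(x_0,x_1,\ldots,x_p)$ in $G$ such that $V(P)\cap D=\{x_0,x_p\}$; $P$ may be closed, i.e. $x_0=x_p$ is allowed. A $D$-ear $P$ is called acceptable if either $P$ is a shortest $D$-ear containing the edge $(x_0,x_1)$, or $P$ is a shortest $D$-ear containing the edge $(x_{p-1},x_p)$. -}

module Defs where

open import Data.Nat using (ℕ; zero; suc; _≤_)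
open import Data.Fin using (Fin; zero; suc; inject₁; fromℕ; toℕ)
open import Data.Fin.Subset using (Subset; _∈_)
open import Data.Product using (Σ; ∃; _×_; _,_)
open import Data.Sum using (_⊎_)
open import Data.Empty using (⊥)
open import Relation.Nullary using (¬_)
open import Relation.Binary.PropositionalEquality using (_≡_)
open import Function.Bundles using (_⇔_)

record Graph (n : ℕ) : Set₁ where
  field
    Adj    : Fin n → Fin n → Set
    sym    : ∀ {u v} → Adj u v → Adj v u
    irrefl : ∀ {u} → ¬ Adj u u
open Graph public

data Walk {n : ℕ} (R : Fin n → Fin n → Set) : Fin n → Fin n → ℕ → Set where
  here : ∀ {u} → Walk R u u zero
  step : ∀ {u v w k} → R u v → Walk R v w k → Walk R u w (suc k)

DistToSet : {n : ℕ} → (Fin n → Fin n → Set) → Fin n → Subset n → ℕ → Set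
DistToSet {n} R x S k =
  (Σ (Fin n) λ s → s ∈ S × Walk R x s k) ×
  (∀ (s : Fin n) (m : ℕ) → s ∈ S → Walk R x s m → k ≤ m)

-- Consecutive vertices are adjacent; vertices are pairwise distinct except
-- that x_0 = x_p is allowed (closed path, i.e. a cycle, which then has p ≥ 3).
record Path {n : ℕ} (G : Graph n) : Set where
  constructor mkPath
  field
    len  : ℕ
    vtx  : Fin (suc len) → Fin n
    adj  : ∀ (i : Fin len) → Adj G (vtx (inject₁ i)) (vtx (suc i))
    dist : ∀ (i j : Fin (suc len)) → vtx i ≡ vtx j →
             i ≡ j ⊎ (i ≡ zero × j ≡ fromℕ len) ⊎ (i ≡ fromℕ len × j ≡ zero)
    closed⇒cycle : vtx zero ≡ vtx (fromℕ len) → 3 ≤ len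
open Path public

IsEar : {n : ℕ} {G : Graph n} → Subset n → Path G → Set
IsEar D P = ∀ (i : Fin (suc (len P))) →
  (vtx P i ∈ D) ⇔ (i ≡ zero ⊎ i ≡ fromℕ (len P))

IsEdgeAt : {n : ℕ} {G : Graph n} → (P : Path G) → Fin (len P) → Fin n → Fin n → Set
IsEdgeAt P i u v =
  (vtx P (inject₁ i) ≡ u × vtx P (suc i) ≡ v) ⊎
  (vtx P (inject₁ i) ≡ v × vtx P (suc i) ≡ u)

ContainsEdge : {n : ℕ} {G : Graph n} → Path G → Fin n → Fin n → Set
ContainsEdge P u v = Σ (Fin (len P)) λ i → IsEdgeAt P i u v

ShortestEarThrough : {n : ℕ} {G : Graph n} → Subset n → (P : Path G) → Fin (len P) → Set
ShortestEarThrough {G = G} D P i =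
  IsEar D P ×
  (∀ (Q : Path G) → IsEar D Q →
     ContainsEdge Q (vtx P (inject₁ i)) (vtx P (suc i)) → len P ≤ len Q)

Acceptable : {n : ℕ} {G : Graph n} → Subset n → Path G → Set
Acceptable D P =
  (Σ (Fin (len P)) λ i → toℕ i ≡ 0 × ShortestEarThrough D P i) ⊎
  (Σ (Fin (len P)) λ i → suc (toℕ i) ≡ len P × ShortestEarThrough D P i)

PathAdj : {n : ℕ} {G : Graph n} → Path G → Fin n → Fin n → Set
PathAdj P u v = ContainsEdge P u v

-- Reversing P if
-- necessary, P is a shortest D-ear through its first edge x 0 x 1.  Inside P
-- the vertex x j reaches D in j and in p ∸ j steps, so it suffices to show
-- that every walk of G from x j to D has length ≥ j or ≥ p ∸ j.  Cut such a
-- walk q at its first vertex in D.  Then either x 1, …, x j followed by q,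
-- or (when q ends with the step x 1 → x 0) q walked back from x 1 to x j
-- followed by x j, …, x p, is a detour: a walk from x 1 that avoids D until
-- it ends in D.  Cutting out loops and prefixing x 0 turns a detour into a
-- D-ear through x 0 x 1, and minimality of P bounds the detour's length.
module Submission where

open import Defs renaming (sym to adj-sym)
open import Data.Nat using (ℕ; zero; suc; _+_; _∸_; _≤_; _<_; z≤n; s≤s; pred; _≤?_; _<?_)
open import Data.Nat.Properties hiding (_≟_)
open import Data.Fin using (Fin; zero; suc; toℕ; inject₁; fromℕ; fromℕ<; _≟_)
open import Data.Fin.Properties
  using (toℕ-injective; toℕ-inject₁; toℕ-fromℕ; toℕ-fromℕ<; toℕ<n; toℕ≤pred[n])
open import Data.Fin.Subset using (Subset; _∈_; _∉_)
open import Data.Fin.Subset.Properties using (_∈?_)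
open import Data.Product using (Σ; _×_; _,_; proj₁; proj₂)
open import Data.Sum using (_⊎_; inj₁; inj₂) renaming (map to map⊎)
open import Data.Empty using (⊥; ⊥-elim)
open import Relation.Nullary using (¬_; yes; no; _×-dec_; contradiction)
open import Relation.Unary using (Decidable)
open import Relation.Binary.Definitions using (DecidableEquality)
open import Relation.Binary.PropositionalEquality
open import Function.Base using (_∘_)
open import Function.Bundles using (_⇔_; mk⇔; Equivalence)
open import Induction.WellFounded using (WfRec)
open import Data.Nat.Induction using (<-rec)

IsWalk : {n : ℕ} → (Fin n → Fin n → Set) → (ℕ → Fin n) → ℕ → Set
IsWalk R f r = ∀ k → k < r → R (f k) (f (suc k))

module _ {n : ℕ} {R : Fin n → Fin n → Set} where

  seq→walk : ∀ (f : ℕ → Fin n) r → IsWalk R f r → Walk R (f 0) (f r) r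
  seq→walk f zero    _ = here
  seq→walk f (suc r) w =
    step (w 0 (s≤s z≤n)) (seq→walk (λ k → f (suc k)) r (λ k k<r → w (suc k) (s≤s k<r)))

  walk→seq : ∀ {u v r} → Walk R u v r →
             Σ (ℕ → Fin n) λ f → f 0 ≡ u × f r ≡ v × IsWalk R f r
  walk→seq {u} here = (λ _ → u) , refl , refl , λ _ ()
  walk→seq {u} (step e W) with walk→seq W
  ... | f , f0 , fr , w = g , refl , fr , wg
    where
      g : ℕ → Fin n
      g zero    = u
      g (suc k) = f k
      wg : IsWalk R g _
      wg zero    _         = subst (R u) (sym f0) e
      wg (suc k) (s≤s k<r) = w k k<r

  walk-prefix : ∀ {f d r} → d ≤ r → IsWalk R f r → IsWalk R f d
  walk-prefix d≤r w k k<d = w k (<-≤-trans k<d d≤r)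

  walk-suffix : ∀ {f} a {d r} → a + d ≤ r → IsWalk R f r → IsWalk R (λ k → f (a + k)) d
  walk-suffix {f} a a+d≤r w k k<d =
    subst (λ i → R (f (a + k)) (f i)) (sym (+-suc a k))
          (w (a + k) (<-≤-trans (+-monoʳ-< a k<d) a+d≤r))

  walk-reverse : (∀ {u v} → R u v → R v u) →
                 ∀ {f r} → IsWalk R f r → IsWalk R (λ k → f (r ∸ k)) r
  walk-reverse R-sym {f} {r} w k k<r =
    subst (λ i → R (f i) (f (r ∸ suc k))) (sym (+-∸-assoc 1 k<r))
          (R-sym (w (r ∸ suc k) (∸-monoʳ-< (s≤s z≤n) k<r)))

map-walk : ∀ {n} {R S : Fin n → Fin n → Set} → (∀ {u v} → R u v → S u v) →
           ∀ {u v k} → Walk R u v k → Walk S u v k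
map-walk R⊆S here       = here
map-walk R⊆S (step e W) = step (R⊆S e) (map-walk R⊆S W)

module _ {A : Set} where

  splice : ℕ → (ℕ → A) → (ℕ → A) → ℕ → A
  splice c f g k with k ≤? c
  ... | yes _ = f k
  ... | no  _ = g (k ∸ c)

  splice-head : ∀ c (f g : ℕ → A) {k} → k ≤ c → splice c f g k ≡ f k
  splice-head c f g {k} k≤c with k ≤? c
  ... | yes _   = refl
  ... | no  k≰c = contradiction k≤c k≰c

  splice-tail : ∀ c (f g : ℕ → A) → f c ≡ g 0 → ∀ d → splice c f g (c + d) ≡ g d
  splice-tail c f g fc≡g0 zero = begin
    splice c f g (c + 0) ≡⟨ splice-head c f g (≤-reflexive (+-identityʳ c)) ⟩
    f (c + 0)            ≡⟨ cong f (+-identityʳ c) ⟩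
    f c                  ≡⟨ fc≡g0 ⟩
    g 0                  ∎
    where open ≡-Reasoning
  splice-tail c f g fc≡g0 (suc d) with c + suc d ≤? c
  ... | yes c+d<c = contradiction c+d<c (m+1+n≰m c)
  ... | no  _     = cong g (m+n∸m≡n c (suc d))

  splice-pred-tail : ∀ c (f g : ℕ → A) → f c ≡ g 0 → ∀ d → splice c f g (pred (c + suc d)) ≡ g d
  splice-pred-tail c f g fc≡g0 d =
    trans (cong (λ k → splice c f g (pred k)) (+-suc c d)) (splice-tail c f g fc≡g0 d)

  splice-all : ∀ (Q : A → Set) c d (f g : ℕ → A) →
               (∀ k → k ≤ c → Q (f k)) → (∀ k → k < d → Q (g k)) →
               ∀ k → k < c + d → Q (splice c f g k)
  splice-all Q c d f g Qf Qg k k<c+d with k ≤? c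
  ... | yes k≤c = Qf k k≤c
  ... | no  k≰c = Qg (k ∸ c)
    (subst (k ∸ c <_) (m+n∸m≡n c d) (∸-monoˡ-< k<c+d (<⇒≤ (≰⇒> k≰c))))

splice-walk : ∀ {n} {R : Fin n → Fin n → Set} c d (f g : ℕ → Fin n) → f c ≡ g 0 →
              IsWalk R f c → IsWalk R g d → IsWalk R (splice c f g) (c + d)
splice-walk {R = R} c d f g fc≡g0 wf wg k k<c+d with <-≤-connex k c
... | inj₁ k<c =
  subst₂ R (sym (splice-head c f g (<⇒≤ k<c))) (sym (splice-head c f g k<c)) (wf k k<c)
... | inj₂ c≤k with m≤n⇒∃[o]m+o≡n c≤k
...   | i , refl =
  subst₂ R (sym (splice-tail c f g fc≡g0 i))
           (sym (trans (cong (splice c f g) (sym (+-suc c i))) (splice-tail c f g fc≡g0 (suc i))))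
           (wg i (+-cancelˡ-< c i d k<c+d))

search : {P : ℕ → Set} → Decidable P → ∀ r →
         (Σ ℕ λ j → j ≤ r × P j × (∀ k → k < j → ¬ P k)) ⊎ (∀ j → j ≤ r → ¬ P j)
search P? r with P? 0
... | yes p0 = inj₁ (0 , z≤n , p0 , λ _ ())
search P? zero    | no ¬p0 = inj₂ λ { zero _ → ¬p0 }
search {P} P? (suc r) | no ¬p0 with search {λ k → P (suc k)} (λ k → P? (suc k)) r
... | inj₁ (j , j≤r , pj , below) =
  inj₁ (suc j , s≤s j≤r , pj , λ { zero _ → ¬p0 ; (suc k) (s≤s k<j) → below k k<j })
... | inj₂ none = inj₂ λ { zero _ → ¬p0 ; (suc j) (s≤s j≤r) → none j j≤r }

module _ {A : Set} where

  Repeat : (ℕ → A) → ℕ → Set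
  Repeat f r = Σ ℕ λ i → Σ ℕ λ j → i < j × j ≤ r × f i ≡ f j

  Distinct : (ℕ → A) → ℕ → Set
  Distinct f r = ∀ i j → i ≤ r → j ≤ r → f i ≡ f j → i ≡ j

  repeat? : DecidableEquality A → ∀ f r → Repeat f r ⊎ Distinct f r
  repeat? _≟_ f zero = inj₂ λ { zero zero z≤n z≤n _ → refl }
  repeat? _≟_ f (suc r) with search (λ j → f 0 ≟ f (suc j)) r
  ... | inj₁ (j , j≤r , f0≡fj , _) = inj₁ (0 , suc j , s≤s z≤n , s≤s j≤r , f0≡fj)
  ... | inj₂ f0-new with repeat? _≟_ (λ k → f (suc k)) r
  ...   | inj₁ (i , j , i<j , j≤r , e) = inj₁ (suc i , suc j , s≤s i<j , s≤s j≤r , e)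
  ...   | inj₂ tail-distinct = inj₂ λ where
            zero    zero    _         _         _ → refl
            zero    (suc j) _         (s≤s j≤r) e → contradiction e (f0-new j j≤r)
            (suc i) zero    (s≤s i≤r) _         e → contradiction (sym e) (f0-new i i≤r)
            (suc i) (suc j) (s≤s i≤r) (s≤s j≤r) e → cong suc (tail-distinct i j i≤r j≤r e)

module _ {n : ℕ} (G : Graph n) where

  DistinctButEnds : (ℕ → Fin n) → ℕ → Set
  DistinctButEnds v ℓ = ∀ a b → a ≤ ℓ → b ≤ ℓ → v a ≡ v b →
                          a ≡ b ⊎ (a ≡ 0 × b ≡ ℓ) ⊎ (a ≡ ℓ × b ≡ 0)

  seqPath : ∀ ℓ (v : ℕ → Fin n) → IsWalk (Adj G) v ℓ → DistinctButEnds v ℓ →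
            (v 0 ≡ v ℓ → 3 ≤ ℓ) → Path G
  seqPath ℓ v walk distinct closed = mkPath ℓ (λ t → v (toℕ t)) edge fin-distinct closed′
    where
      edge : ∀ (i : Fin ℓ) → Adj G (v (toℕ (inject₁ i))) (v (suc (toℕ i)))
      edge i = subst (λ a → Adj G (v a) (v (suc (toℕ i)))) (sym (toℕ-inject₁ i))
                     (walk (toℕ i) (toℕ<n i))
      toℕ-fromℕ-inj : ∀ {t : Fin (suc ℓ)} → toℕ t ≡ ℓ → t ≡ fromℕ ℓ
      toℕ-fromℕ-inj t≡ℓ = toℕ-injective (trans t≡ℓ (sym (toℕ-fromℕ ℓ)))
      fin-distinct : ∀ (i j : Fin (suc ℓ)) → v (toℕ i) ≡ v (toℕ j) →
                     i ≡ j ⊎ (i ≡ zero × j ≡ fromℕ ℓ) ⊎ (i ≡ fromℕ ℓ × j ≡ zero)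
      fin-distinct i j e with distinct (toℕ i) (toℕ j) (toℕ≤pred[n] i) (toℕ≤pred[n] j) e
      ... | inj₁ i≡j              = inj₁ (toℕ-injective i≡j)
      ... | inj₂ (inj₁ (i≡0 , j≡ℓ)) = inj₂ (inj₁ (toℕ-injective i≡0 , toℕ-fromℕ-inj j≡ℓ))
      ... | inj₂ (inj₂ (i≡ℓ , j≡0)) = inj₂ (inj₂ (toℕ-fromℕ-inj i≡ℓ , toℕ-injective j≡0))
      closed′ : v 0 ≡ v (toℕ (fromℕ ℓ)) → 3 ≤ ℓ
      closed′ e = closed (trans e (cong v (toℕ-fromℕ ℓ)))

  seqPath-ear : ∀ (D : Subset n) ℓ v walk distinct closed →
                v 0 ∈ D → v ℓ ∈ D → (∀ a → 0 < a → a < ℓ → v a ∉ D) →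
                IsEar D (seqPath ℓ v walk distinct closed)
  seqPath-ear D ℓ v _ _ _ v0∈D vℓ∈D inner∉D t = mk⇔ to from
    where
      to : v (toℕ t) ∈ D → t ≡ zero ⊎ t ≡ fromℕ ℓ
      to vt∈D with toℕ t in eq
      ... | zero  = inj₁ (toℕ-injective eq)
      ... | suc a with m≤n⇒m<n∨m≡n (subst (_≤ ℓ) eq (toℕ≤pred[n] t))
      ...   | inj₁ a<ℓ = contradiction vt∈D (inner∉D (suc a) (s≤s z≤n) a<ℓ)
      ...   | inj₂ a≡ℓ = inj₂ (toℕ-injective (trans eq (trans a≡ℓ (sym (toℕ-fromℕ ℓ)))))
      from : t ≡ zero ⊎ t ≡ fromℕ ℓ → v (toℕ t) ∈ D
      from (inj₁ refl) = v0∈D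
      from (inj₂ refl) = subst (λ a → v a ∈ D) (sym (toℕ-fromℕ ℓ)) vℓ∈D

Reach : {n : ℕ} → (Fin n → Fin n → Set) → Fin n → Subset n → ℕ → Set
Reach {n} R v S m = Σ (Fin n) λ s → s ∈ S × Walk R v s m

distance-transfer :
  ∀ {n} {R R' : Fin n → Fin n → Set} {v : Fin n} {S : Subset n} {a b : ℕ} →
  (∀ {u w} → R' u w → R u w) → Reach R' v S a → Reach R' v S b →
  (∀ s m → s ∈ S → Walk R v s m → a ≤ m ⊎ b ≤ m) →
  ∀ k → DistToSet R v S k ⇔ DistToSet R' v S k
distance-transfer {R = R} {R'} {v} {S} {a} {b} R'⊆R
                  reach-a@(sa , sa∈S , Wa) reach-b@(sb , sb∈S , Wb) bound k = mk⇔ to from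
  where
    to : DistToSet R v S k → DistToSet R' v S k
    to ((s , s∈S , W) , minimal) =
      reach-k , λ s′ m s′∈S W′ → minimal s′ m s′∈S (map-walk R'⊆R W′)
      where
        k≤a : k ≤ a
        k≤a = minimal sa a sa∈S (map-walk R'⊆R Wa)
        k≤b : k ≤ b
        k≤b = minimal sb b sb∈S (map-walk R'⊆R Wb)
        reach-k : Reach R' v S k
        reach-k with bound s k s∈S W
        ... | inj₁ a≤k = subst (Reach R' v S) (≤-antisym a≤k k≤a) reach-a
        ... | inj₂ b≤k = subst (Reach R' v S) (≤-antisym b≤k k≤b) reach-b
    from : DistToSet R' v S k → DistToSet R v S k
    from ((s , s∈S , W) , minimal) = (s , s∈S , map-walk R'⊆R W) , minimal′
      where
        minimal′ : ∀ s′ m → s′ ∈ S → Walk R v s′ m → k ≤ m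
        minimal′ s′ m s′∈S W′ with bound s′ m s′∈S W′
        ... | inj₁ a≤m = ≤-trans (minimal sa a sa∈S Wa) a≤m
        ... | inj₂ b≤m = ≤-trans (minimal sb b sb∈S Wb) b≤m

-- An ear presented as a vertex sequence x 0, …, x p: a walk in G meeting D
-- exactly at its two endpoints, which does not finish by traversing its
-- first edge backwards (i.e. it is not the closed walk x 0, x 1, x 0).
record EarSequence {n : ℕ} (G : Graph n) (D : Subset n) : Set where
  field
    p        : ℕ
    x        : ℕ → Fin n
    walk     : IsWalk (Adj G) x p
    start∈D  : x 0 ∈ D
    end∈D    : x p ∈ D
    inner∉D  : ∀ k → 0 < k → k < p → x k ∉ D
    no-digon : 2 ≤ p → x (pred p) ≡ x 1 → x p ≡ x 0 → ⊥

module _ {n : ℕ} {G : Graph n} {D : Subset n} where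
  open EarSequence

  ShortestThroughFirstEdge : EarSequence G D → Set
  ShortestThroughFirstEdge E =
    ∀ (Q : Path G) → IsEar D Q → ContainsEdge Q (x E 0) (x E 1) → p E ≤ len Q

  DistanceBound : EarSequence G D → ℕ → Set
  DistanceBound E j = ∀ s m → s ∈ D → Walk (Adj G) (x E j) s m → j ≤ m ⊎ p E ∸ j ≤ m

  pred≡∸1 : ∀ m → pred m ≡ m ∸ 1
  pred≡∸1 zero    = refl
  pred≡∸1 (suc m) = refl

  reverse : EarSequence G D → EarSequence G D
  reverse E = record
    { p        = p E
    ; x        = λ k → x E (p E ∸ k)
    ; walk     = walk-reverse {R = Adj G} (adj-sym G) (walk E)
    ; start∈D  = end∈D E
    ; end∈D    = subst (λ k → x E k ∈ D) (sym (n∸n≡0 (p E))) (start∈D E)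
    ; inner∉D  = λ k 0<k k<p →
                   inner∉D E (p E ∸ k) (m<n⇒0<n∸m k<p) (∸-monoʳ-< 0<k (<⇒≤ k<p))
    ; no-digon = reversed-no-digon
    }
    where
      reversed-no-digon : 2 ≤ p E → x E (p E ∸ pred (p E)) ≡ x E (p E ∸ 1) →
                          x E (p E ∸ p E) ≡ x E (p E ∸ 0) → ⊥
      reversed-no-digon 2≤p e₁ e₂ = no-digon E 2≤p (sym (trans at-1 (trans e₁ at-pred)))
                                                    (sym (trans (cong (x E) (sym (n∸n≡0 (p E)))) e₂))
        where
          at-1 : x E 1 ≡ x E (p E ∸ pred (p E))
          at-1 = cong (x E) (sym (trans (cong (p E ∸_) (pred≡∸1 (p E)))
                                        (m∸[m∸n]≡n (<⇒≤ 2≤p))))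
          at-pred : x E (p E ∸ 1) ≡ x E (pred (p E))
          at-pred = cong (x E) (sym (pred≡∸1 (p E)))

  reverse-bound : ∀ E j → j ≤ p E → DistanceBound (reverse E) (p E ∸ j) → DistanceBound E j
  reverse-bound E j j≤p bound s m s∈D W
    with bound s m s∈D (subst (λ v → Walk (Adj G) v s m) (cong (x E) (sym (m∸[m∸n]≡n j≤p))) W)
  ... | inj₁ p∸j≤m  = inj₂ p∸j≤m
  ... | inj₂ j′≤m   = inj₁ (subst (_≤ m) (m∸[m∸n]≡n j≤p) j′≤m)

module EarBound {n : ℕ} {G : Graph n} {D : Subset n}
                (E : EarSequence G D) (shortest : ShortestThroughFirstEdge E) where
  open EarSequence E

  -- A detour of length r: a walk from x 1 that stays outside D until its
  -- last vertex, which lies in D, and does not end with the step x 1 → x 0.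
  -- Prefixing x 0 turns a detour into a D-ear through the edge x 0 x 1.
  record Detour (w : ℕ → Fin n) (r : ℕ) : Set where
    field
      starts    : w 0 ≡ x 1
      steps     : IsWalk (Adj G) w r
      lands     : w r ∈ D
      avoids    : ∀ k → k < r → w k ∉ D
      no-return : w (pred r) ≡ x 1 → w r ≡ x 0 → ⊥

  -- A detour returning to x 0 has length at least 2: x 1 ∉ D, and the
  -- step x 1 → x 0 is excluded by no-return.
  detour-closed : 1 < p → ∀ {w} r → Detour w r → x 0 ≡ w r → 2 ≤ r
  detour-closed 1<p zero          δ x0≡w0 =
    contradiction (subst (_∈ D) (trans x0≡w0 (Detour.starts δ)) start∈D) (inner∉D 1 (s≤s z≤n) 1<p)
  detour-closed 1<p (suc zero)    δ x0≡w1 = ⊥-elim (Detour.no-return δ (Detour.starts δ) (sym x0≡w1))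
  detour-closed 1<p (suc (suc r)) δ _     = s≤s (s≤s z≤n)

  -- A detour without repeated vertices yields, after prefixing x 0, a
  -- D-ear through x 0 x 1 of length suc r; minimality of E bounds p by it.
  distinct-detour-bound : 1 < p → ∀ {w r} → Detour w r → Distinct w r → p ≤ suc r
  distinct-detour-bound 1<p {w} {r} δ distinct = shortest Q Q-ear (zero , inj₁ (refl , starts))
    where
      open Detour δ
      v : ℕ → Fin n
      v zero    = x 0
      v (suc k) = w k
      v-walk : IsWalk (Adj G) v (suc r)
      v-walk zero    _         = subst (Adj G (x 0)) (sym starts) (walk 0 (<-trans (s≤s z≤n) 1<p))
      v-walk (suc k) (s≤s k<r) = steps k k<r
      v-inner : ∀ a → 0 < a → a < suc r → v a ∉ D
      v-inner (suc k) _ (s≤s k<r) = avoids k k<r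
      last-in-D : ∀ l → l ≤ r → w l ∈ D → suc l ≡ suc r
      last-in-D l l≤r wl∈D with m≤n⇒m<n∨m≡n l≤r
      ... | inj₁ l<r = contradiction wl∈D (avoids l l<r)
      ... | inj₂ l≡r = cong suc l≡r
      v-distinct : DistinctButEnds G v (suc r)
      v-distinct zero    zero    _          _          _ = inj₁ refl
      v-distinct zero    (suc l) _          (s≤s l≤r) e =
        inj₂ (inj₁ (refl , last-in-D l l≤r (subst (_∈ D) e start∈D)))
      v-distinct (suc l) zero    (s≤s l≤r) _          e =
        inj₂ (inj₂ (last-in-D l l≤r (subst (_∈ D) (sym e) start∈D) , refl))
      v-distinct (suc k) (suc l) (s≤s k≤r) (s≤s l≤r) e = inj₁ (cong suc (distinct k l k≤r l≤r e))
      v-closed : v 0 ≡ v (suc r) → 3 ≤ suc r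
      v-closed e = s≤s (detour-closed 1<p r δ e)
      Q : Path G
      Q = seqPath G (suc r) v v-walk v-distinct v-closed
      Q-ear : IsEar D Q
      Q-ear = seqPath-ear G D (suc r) v v-walk v-distinct v-closed start∈D lands v-inner

  -- If a detour of length j + suc e visits the same vertex at i < j, cutting
  -- out the closed subwalk between the two visits leaves a detour of length
  -- i + suc e; its last two vertices are unchanged.
  cut-loop : ∀ {w i j e} → Detour w (j + suc e) → i < j → w i ≡ w j →
             Detour (splice i w (λ k → w (j + k))) (i + suc e)
  cut-loop {w} {i} {j} {e} δ i<j wi≡wj = record
    { starts    = trans (splice-head i w tail z≤n) starts
    ; steps     = splice-walk {R = Adj G} i (suc e) w tail wi≡wj′
                    (walk-prefix {R = Adj G} {f = w} (≤-trans (<⇒≤ i<j) (m≤m+n j (suc e))) steps)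
                    (walk-suffix {R = Adj G} {f = w} j ≤-refl steps)
    ; lands     = subst (_∈ D) (sym (splice-tail i w tail wi≡wj′ (suc e))) lands
    ; avoids    = splice-all (_∉ D) i (suc e) w tail
                    (λ k k≤i → avoids k (<-≤-trans (≤-<-trans k≤i i<j) (m≤m+n j (suc e))))
                    (λ k k<1+e → avoids (j + k) (+-monoʳ-< j k<1+e))
    ; no-return = λ back home →
        no-return (trans (cong w (cong pred (+-suc j e)))
                     (trans (sym (splice-pred-tail i w tail wi≡wj′ e)) back))
                  (trans (sym (splice-tail i w tail wi≡wj′ (suc e))) home)
    }
    where
      open Detour δ
      tail : ℕ → Fin n
      tail k = w (j + k)
      wi≡wj′ : w i ≡ tail 0
      wi≡wj′ = trans wi≡wj (cong w (sym (+-identityʳ j)))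

  -- Every detour has length at least p ∸ 1: cut out loops (strong induction
  -- on the length) until no vertex repeats, then apply distinct-detour-bound.
  detour-bound : 1 < p → ∀ r {w} → Detour w r → p ≤ suc r
  detour-bound 1<p = <-rec Bounded bound
    where
      Bounded : ℕ → Set
      Bounded r = ∀ {w} → Detour w r → p ≤ suc r
      bound : ∀ r → WfRec _<_ Bounded r → Bounded r
      bound r shorter {w} δ with repeat? _≟_ w r
      ... | inj₂ distinct = distinct-detour-bound 1<p δ distinct
      ... | inj₁ (i , j , i<j , j≤r , wi≡wj) with m≤n⇒m<n∨m≡n j≤r
      ...   | inj₂ refl =
        contradiction (subst (_∈ D) (sym wi≡wj) (Detour.lands δ)) (Detour.avoids δ i i<j)
      ...   | inj₁ j<r with m≤n⇒∃[o]m+o≡n j<r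
      ...     | e , refl = ≤-trans (shorter cut<r cut) (s≤s (<⇒≤ cut<r))
        where
          cut : Detour (splice i w (λ k → w (j + k))) (i + suc e)
          cut = cut-loop (subst (Detour w) (sym (+-suc j e)) δ) i<j wi≡wj
          cut<r : i + suc e < suc (j + e)
          cut<r = subst (_< suc (j + e)) (sym (+-suc i e)) (s≤s (+-monoˡ-< e i<j))

  -- Walking E back from x (suc j) to x 1 and then along q
  -- is a detour, unless q ends with the step x 1 → x 0.
  forward-detour : ∀ {j q m} → suc j < p → q 0 ≡ x (suc j) → IsWalk (Adj G) q (suc m) →
                   q (suc m) ∈ D → (∀ k → k ≤ m → q k ∉ D) →
                   (q m ≡ x 1 → q (suc m) ≡ x 0 → ⊥) →
                   Detour (splice j (λ k → x (suc k)) q) (j + suc m)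
  forward-detour {j} {q} {m} j<p q0≡xj q-walk q-lands q-avoids q-no-return = record
    { starts    = splice-head j along-E q z≤n
    ; steps     = splice-walk {R = Adj G} j (suc m) along-E q (sym q0≡xj)
                    (walk-suffix {R = Adj G} {f = x} 1 (<⇒≤ j<p) walk) q-walk
    ; lands     = subst (_∈ D) (sym (splice-tail j along-E q (sym q0≡xj) (suc m))) q-lands
    ; avoids    = splice-all (_∉ D) j (suc m) along-E q
                    (λ k k≤j → inner∉D (suc k) (s≤s z≤n) (≤-<-trans (s≤s k≤j) j<p))
                    (λ k k<1+m → q-avoids k (≤-pred k<1+m))
    ; no-return = λ back home →
        q-no-return (trans (sym (splice-pred-tail j along-E q (sym q0≡xj) m)) back)
                    (trans (sym (splice-tail j along-E q (sym q0≡xj) (suc m))) home)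
    }
    where
      along-E : ℕ → Fin n
      along-E k = x (suc k)

  backward-detour : ∀ {j e q m} → 0 < j → p ≡ j + suc e → q 0 ≡ x j → IsWalk (Adj G) q (suc m) →
                    (∀ k → k ≤ m → q k ∉ D) → q m ≡ x 1 →
                    Detour (splice m (λ k → q (m ∸ k)) (λ k → x (j + k))) (m + suc e)
  backward-detour {j} {e} {q} {m} 0<j p≡j+1+e q0≡xj q-walk q-avoids back = record
    { starts    = trans (splice-head m back-along-q along-E z≤n) back
    ; steps     = splice-walk {R = Adj G} m (suc e) back-along-q along-E junction
                    (walk-reverse {R = Adj G} (adj-sym G)
                                  (walk-prefix {R = Adj G} {f = q} (n≤1+n m) q-walk))
                    (walk-suffix {R = Adj G} {f = x} j (≤-reflexive (sym p≡j+1+e)) walk)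
    ; lands     = subst (_∈ D) (sym reaches-end) end∈D
    ; avoids    = splice-all (_∉ D) m (suc e) back-along-q along-E
                    (λ k _ → q-avoids (m ∸ k) (m∸n≤m m k))
                    (λ k k<1+e → inner∉D (j + k) (<-≤-trans 0<j (m≤m+n j k))
                                   (subst (j + k <_) (sym p≡j+1+e) (+-monoʳ-< j k<1+e)))
    ; no-return = λ back′ home →
        no-digon 2≤p (trans (sym reaches-pred-end) back′) (trans (sym reaches-end) home)
    }
    where
      back-along-q along-E : ℕ → Fin n
      back-along-q k = q (m ∸ k)
      along-E k = x (j + k)
      junction : back-along-q m ≡ along-E 0
      junction = trans (cong q (n∸n≡0 m)) (trans q0≡xj (cong x (sym (+-identityʳ j))))
      reaches-end : splice m back-along-q along-E (m + suc e) ≡ x p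
      reaches-end = trans (splice-tail m back-along-q along-E junction (suc e)) (cong x (sym p≡j+1+e))
      reaches-pred-end : splice m back-along-q along-E (pred (m + suc e)) ≡ x (pred p)
      reaches-pred-end = trans (splice-pred-tail m back-along-q along-E junction e)
                               (cong x (sym (trans (cong pred p≡j+1+e) (cong pred (+-suc j e)))))
      2≤p : 2 ≤ p
      2≤p = subst (2 ≤_) (sym p≡j+1+e) (+-mono-≤ 0<j (s≤s z≤n))

  exit-bound : ∀ {j q m} → 0 < j → j < p → q 0 ≡ x j → IsWalk (Adj G) q (suc m) →
               q (suc m) ∈ D → (∀ k → k ≤ m → q k ∉ D) → j ≤ suc m ⊎ p ∸ j ≤ suc m
  exit-bound {suc j} {q} {m} _ j<p q0≡xj q-walk q-lands q-avoids
    with (q m ≟ x 1) ×-dec (q (suc m) ≟ x 0)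
  ... | no ¬returns = inj₂ (m≤n+o⇒m∸n≤o p (suc j) p≤j+m)
    where
      p≤j+m : p ≤ suc j + suc m
      p≤j+m = detour-bound (≤-<-trans (s≤s z≤n) j<p) (j + suc m)
                (forward-detour j<p q0≡xj q-walk q-lands q-avoids (λ back home → ¬returns (back , home)))
  ... | yes (back , _) with m≤n⇒∃[o]m+o≡n j<p
  ...   | e , j+1+e≡p = inj₁ (+-cancelʳ-≤ (suc e) (suc j) (suc m) j+e≤m+e)
    where
      p≡j+1+e : p ≡ suc j + suc e
      p≡j+1+e = trans (sym j+1+e≡p) (sym (+-suc (suc j) e))
      j+e≤m+e : suc j + suc e ≤ suc m + suc e
      j+e≤m+e = subst (_≤ suc m + suc e) p≡j+1+e
                  (detour-bound (≤-<-trans (s≤s z≤n) j<p) (m + suc e)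
                    (backward-detour (s≤s z≤n) p≡j+1+e q0≡xj q-walk q-avoids back))

  -- The main estimate: E admits the distance bound at every position.
  -- Truncate a walk from x j at its first vertex in D and apply exit-bound.
  distance-bound : ∀ j → DistanceBound E j
  distance-bound zero    _ _ _    _ = inj₁ z≤n
  distance-bound (suc j) s m s∈D W with suc j <? p
  ... | no j≮p = inj₂ (subst (_≤ m) (sym (m≤n⇒m∸n≡0 (≮⇒≥ j≮p))) z≤n)
  ... | yes j<p with walk→seq W
  ...   | q , q0≡xj , qm≡s , q-walk with search (λ k → q k ∈? D) m
  ...     | inj₂ never = contradiction (subst (_∈ D) (sym qm≡s) s∈D) (never m ≤-refl)
  ...     | inj₁ (zero , _ , q0∈D , _) =
    contradiction (subst (_∈ D) q0≡xj q0∈D) (inner∉D (suc j) (s≤s z≤n) j<p)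
  ...     | inj₁ (suc h , h<m , qh∈D , before) =
    map⊎ (λ le → ≤-trans le h<m) (λ le → ≤-trans le h<m)
         (exit-bound (s≤s z≤n) j<p q0≡xj (walk-prefix {R = Adj G} {f = q} h<m q-walk) qh∈D
                     (λ k k≤h → before k (s≤s k≤h)))

-- clamp p k is position k of a path of length p, saturating at p; it lets
-- us read the vertices of a Path as a sequence indexed by ℕ.
clamp : ∀ p → ℕ → Fin (suc p)
clamp p       zero    = zero
clamp zero    (suc k) = zero
clamp (suc p) (suc k) = suc (clamp p k)

clamp-toℕ : ∀ {p} (t : Fin (suc p)) → clamp p (toℕ t) ≡ t
clamp-toℕ           zero    = refl
clamp-toℕ {suc p} (suc t) = cong suc (clamp-toℕ t)

clamp-inject₁ : ∀ {p} (i : Fin p) → clamp p (toℕ i) ≡ inject₁ i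
clamp-inject₁ {suc p} zero    = refl
clamp-inject₁ {suc p} (suc i) = cong suc (clamp-inject₁ i)

clamp-suc : ∀ {p} (i : Fin p) → clamp p (suc (toℕ i)) ≡ suc i
clamp-suc {suc p} i = cong suc (clamp-toℕ i)

clamp-end : ∀ p → clamp p p ≡ fromℕ p
clamp-end p = trans (cong (clamp p) (sym (toℕ-fromℕ p))) (clamp-toℕ (fromℕ p))

clamp≡⇒≡toℕ : ∀ {p k} {t : Fin (suc p)} → k ≤ p → clamp p k ≡ t → k ≡ toℕ t
clamp≡⇒≡toℕ {zero}  {zero}  z≤n       refl = refl
clamp≡⇒≡toℕ {suc p} {zero}  z≤n       refl = refl
clamp≡⇒≡toℕ {suc p} {suc k} (s≤s k≤p) refl = cong suc (clamp≡⇒≡toℕ k≤p refl)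

module _ {n : ℕ} {G : Graph n} (P : Path G) where

  contains-edge-sym : ∀ {u v} → ContainsEdge P u v → ContainsEdge P v u
  contains-edge-sym (i , inj₁ (u≡ , v≡)) = i , inj₂ (u≡ , v≡)
  contains-edge-sym (i , inj₂ (v≡ , u≡)) = i , inj₁ (v≡ , u≡)

  path⊆graph : ∀ {u v} → PathAdj P u v → Adj G u v
  path⊆graph (i , inj₁ (refl , refl)) = adj P i
  path⊆graph (i , inj₂ (refl , refl)) = adj-sym G (adj P i)

-- In a path of length at least 3 the positions pred p and 1 are distinct
-- inner positions; the disjunction has the shape of DistinctButEnds.
pred-and-1-differ : ∀ {p} → 3 ≤ p →
                    ¬ (pred p ≡ 1 ⊎ (pred p ≡ 0 × 1 ≡ p) ⊎ (pred p ≡ p × 1 ≡ 0))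
pred-and-1-differ (s≤s (s≤s (s≤s _))) (inj₁ ())
pred-and-1-differ (s≤s (s≤s (s≤s _))) (inj₂ (inj₁ (() , _)))
pred-and-1-differ (s≤s (s≤s (s≤s _))) (inj₂ (inj₂ (_ , ())))

module PathEar {n : ℕ} {G : Graph n} {D : Subset n} (P : Path G) (ear : IsEar D P) where

  p : ℕ
  p = len P

  x : ℕ → Fin n
  x k = vtx P (clamp p k)

  edge-ends : ∀ (i : Fin p) → vtx P (inject₁ i) ≡ x (toℕ i) × vtx P (suc i) ≡ x (suc (toℕ i))
  edge-ends i = cong (vtx P) (sym (clamp-inject₁ i)) , cong (vtx P) (sym (clamp-suc i))

  path-walk : IsWalk (PathAdj P) x p
  path-walk k k<p = subst (λ a → PathAdj P (x a) (x (suc a))) (toℕ-fromℕ< k<p)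
                          (fromℕ< k<p , inj₁ (edge-ends (fromℕ< k<p)))

  x-distinct : DistinctButEnds G x p
  x-distinct a b a≤p b≤p e with dist P (clamp p a) (clamp p b) e
  ... | inj₁ eq              = inj₁ (trans (clamp≡⇒≡toℕ a≤p eq) (sym (clamp≡⇒≡toℕ b≤p refl)))
  ... | inj₂ (inj₁ (a≡ , b≡)) =
    inj₂ (inj₁ (clamp≡⇒≡toℕ a≤p a≡ , trans (clamp≡⇒≡toℕ b≤p b≡) (toℕ-fromℕ p)))
  ... | inj₂ (inj₂ (a≡ , b≡)) =
    inj₂ (inj₂ (trans (clamp≡⇒≡toℕ a≤p a≡) (toℕ-fromℕ p) , clamp≡⇒≡toℕ b≤p b≡))

  -- P is an ear sequence; it is not a closed walk of length 2 because
  -- closed paths have length at least 3.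
  earSequence : EarSequence G D
  earSequence = record
    { p        = p
    ; x        = x
    ; walk     = λ k k<p → path⊆graph P (path-walk k k<p)
    ; start∈D  = Equivalence.from (ear zero) (inj₁ refl)
    ; end∈D    = subst (_∈ D) at-end (Equivalence.from (ear (fromℕ p)) (inj₂ refl))
    ; inner∉D  = inner∉D
    ; no-digon = λ 2≤p back home →
        pred-and-1-differ (closed⇒cycle P (sym (trans at-end home)))
          (x-distinct (pred p) 1 pred[n]≤n (<⇒≤ 2≤p) back)
    }
    where
      at-end : vtx P (fromℕ p) ≡ x p
      at-end = cong (vtx P) (sym (clamp-end p))
      inner∉D : ∀ k → 0 < k → k < p → x k ∉ D
      inner∉D k 0<k k<p xk∈D with Equivalence.to (ear (clamp p k)) xk∈D
      ... | inj₁ at-start = <⇒≢ 0<k (sym (clamp≡⇒≡toℕ (<⇒≤ k<p) at-start))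
      ... | inj₂ at-end   = <⇒≢ k<p (trans (clamp≡⇒≡toℕ (<⇒≤ k<p) at-end) (toℕ-fromℕ p))

  acceptable⇒shortest : Acceptable D P →
    ShortestThroughFirstEdge earSequence ⊎ ShortestThroughFirstEdge (reverse earSequence)
  acceptable⇒shortest (inj₁ (i , i≡0 , _ , shortest)) = inj₁ λ Q Q-ear through →
    shortest Q Q-ear (subst₂ (ContainsEdge Q) (sym first) (sym second) through)
    where
      first : vtx P (inject₁ i) ≡ x 0
      first = trans (proj₁ (edge-ends i)) (cong x i≡0)
      second : vtx P (suc i) ≡ x 1
      second = trans (proj₂ (edge-ends i)) (cong (x ∘ suc) i≡0)
  acceptable⇒shortest (inj₂ (i , 1+i≡p , _ , shortest)) = inj₂ λ Q Q-ear through →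
    shortest Q Q-ear (subst₂ (ContainsEdge Q) (sym first) (sym second) (contains-edge-sym Q through))
    where
      first : vtx P (inject₁ i) ≡ x (p ∸ 1)
      first = trans (proj₁ (edge-ends i)) (cong x (cong (_∸ 1) 1+i≡p))
      second : vtx P (suc i) ≡ x p
      second = trans (proj₂ (edge-ends i)) (cong x 1+i≡p)

  path-bound : Acceptable D P → ∀ j → j ≤ p → DistanceBound earSequence j
  path-bound acceptable j j≤p with acceptable⇒shortest acceptable
  ... | inj₁ shortest = EarBound.distance-bound earSequence shortest j
  ... | inj₂ shortest = reverse-bound earSequence j j≤p
                          (EarBound.distance-bound (reverse earSequence) shortest (p ∸ j))

  reach-start : ∀ j → j ≤ p → Reach (PathAdj P) (x j) D j
  reach-start j j≤p =
    x (j ∸ j) , subst (λ k → x k ∈ D) (sym (n∸n≡0 j)) (EarSequence.start∈D earSequence)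
    , seq→walk (λ k → x (j ∸ k)) j
        (walk-reverse {R = PathAdj P} (contains-edge-sym P)
                      (walk-prefix {R = PathAdj P} {f = x} j≤p path-walk))

  reach-end : ∀ j → j ≤ p → Reach (PathAdj P) (x j) D (p ∸ j)
  reach-end j j≤p =
    x (j + (p ∸ j)) , subst (λ k → x k ∈ D) (sym (m+[n∸m]≡n j≤p)) (EarSequence.end∈D earSequence)
    , subst (λ v → Walk (PathAdj P) v (x (j + (p ∸ j))) (p ∸ j)) (cong x (+-identityʳ j))
        (seq→walk (λ k → x (j + k)) (p ∸ j)
          (walk-suffix {R = PathAdj P} {f = x} j (≤-reflexive (m+[n∸m]≡n j≤p)) path-walk))

acceptable⇒ear : ∀ {n} {G : Graph n} {D : Subset n} {P : Path G} → Acceptable D P → IsEar D P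
acceptable⇒ear (inj₁ (_ , _ , ear , _)) = ear
acceptable⇒ear (inj₂ (_ , _ , ear , _)) = ear

lemma2 : ∀ {n : ℕ} (G : Graph n) (D : Subset n) (P : Path G) →
           Acceptable D P →
           ∀ (i : Fin (suc (len P))) (k : ℕ) →
             DistToSet (Adj G) (vtx P i) D k ⇔ DistToSet (PathAdj P) (vtx P i) D k
lemma2 G D P acceptable i k =
  subst (λ v → DistToSet (Adj G) v D k ⇔ DistToSet (PathAdj P) v D k) (cong (vtx P) (clamp-toℕ i))
        (distance-transfer {R = Adj G} {R' = PathAdj P} (path⊆graph P)
                           (reach-start j j≤p) (reach-end j j≤p) (path-bound acceptable j j≤p) k)
  where
    open PathEar {D = D} P (acceptable⇒ear {D = D} {P = P} acceptable)
    j : ℕ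
    j = toℕ i
    j≤p : j ≤ p
    j≤p = toℕ≤pred[n] i
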